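{- Let $x=x_1\cdots x_l$ and $y=y_1\cdots y_l$ be words in $\mathbf N$. Then $u_x\equiv u_y \pmod I$ if and only if $w(x)=w(y)$ and $\alpha(x)=\alpha(y)$.
   Context: The Schur operator $u_i$ ($i\ge1$) acts linearly on the vector space $\mathbf C[\mathbf Y]$ with basis all partitions by $u_i(\lambda)=\mu$ if the Young diagram of $\mu$ is obtained from that of $\lambda$ by adding one box in column $i$ and $\mu$ is a partition, and $u_i(\lambda)=0$ otherwise. $\mathcal U$ is the free associative $\mathbf C$-algebra on $u_1,u_2,\dots$, acting on $\mathbf C[\mathbf Y]$ via this action; for a word $x=x_1\cdots x_l$, $u_x=u_{x_1}\cdots u_{x_l}$. $I$ is the two-sided ideal of elements of $\mathcal U$ annihilating $\mathbf C[\mathbf Y]$, so $u\equiv u'\pmod I$ iff $u(\lambda)=u'(\lambda)$ for all partitions $\lambda$. The weight $w(x)=(w_1(x),w_2(x),\dots)$, where $w_i(x)$ is the number of occurrences of $i$ in $x$. $\alpha(x)=(\alpha_1(x),\alpha_2(x),\dots)$ with $\alpha_i(x)=\max\{w_{i+1}(\tilde x)-w_i(\tilde x):\tilde x\text{ a suffix of }x\}$, where a suffix is a trailing subword $x_j\cdots x_l$, possibly empty. -}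

module Defs where

open import Data.Nat using (ℕ; zero; suc; _∸_; _≤ᵇ_; _≡ᵇ_)
open import Data.Bool using (Bool; true; false; _∧_; if_then_else_)
open import Data.List using (List; []; _∷_; length; upTo; tails; map; foldr)
open import Data.Maybe using (Maybe; just; nothing; _>>=_)
open import Data.Integer using (ℤ; _⊖_; _⊔_; +_)
open import Data.Vec using (Vec; toList)
open import Relation.Binary.PropositionalEquality using (_≡_)

-- A partition is represented by its list of row lengths (the rows of its
-- Young diagram, top to bottom): positive and weakly decreasing.
allPositive : List ℕ → Bool
allPositive [] = true
allPositive (a ∷ l) = (1 ≤ᵇ a) ∧ allPositive l

weaklyDecreasing : List ℕ → Bool
weaklyDecreasing [] = true
weaklyDecreasing (a ∷ []) = true
weaklyDecreasing (a ∷ b ∷ l) = (b ≤ᵇ a) ∧ weaklyDecreasing (b ∷ l)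

isPartition : List ℕ → Bool
isPartition l = allPositive l ∧ weaklyDecreasing l

IsPartition : List ℕ → Set
IsPartition l = isPartition l ≡ true

-- length of row r (rows indexed from 0); rows beyond the diagram have length 0
rowLen : ℕ → List ℕ → ℕ
rowLen r [] = 0
rowLen zero (a ∷ l) = a
rowLen (suc r) (a ∷ l) = rowLen r l

-- add one box at the end of row r (r = length λ means: start a new row)
incAt : ℕ → List ℕ → List ℕ
incAt zero [] = 1 ∷ []
incAt zero (a ∷ l) = suc a ∷ l
incAt (suc r) [] = []
incAt (suc r) (a ∷ l) = a ∷ incAt r l

firstJust : List (Maybe (List ℕ)) → Maybe (List ℕ)
firstJust [] = nothing
firstJust (just m ∷ _) = just m
firstJust (nothing ∷ l) = firstJust l

-- Schur operator u_i on a basis element λ.  `nothing` stands for 0.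
-- Adding a box in column i (i ≥ 1) means adding it at position (r , i) for
-- some row r with rowLen r λ = i - 1 (r ≤ length λ); the result counts only if
-- it is a partition (there is at most one such r).
schurOp : ℕ → List ℕ → Maybe (List ℕ)
schurOp zero λ' = nothing
schurOp (suc j) λ' = firstJust (map candidate (upTo (suc (length λ'))))
  where
  candidate : ℕ → Maybe (List ℕ)
  candidate r = if (rowLen r λ' ≡ᵇ j) ∧ isPartition (incAt r λ')
                then just (incAt r λ') else nothing

-- u_x = u_{x_1} ⋯ u_{x_l}, applied to λ (so x_l acts first); nothing = 0
schurWord : List ℕ → List ℕ → Maybe (List ℕ)
schurWord [] λ' = just λ'
schurWord (i ∷ x) λ' = schurWord x λ' >>= schurOp i

EquivModI : List ℕ → List ℕ → Set
EquivModI x y = (λ' : List ℕ) → IsPartition λ' → schurWord x λ' ≡ schurWord y λ'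

wt : ℕ → List ℕ → ℕ
wt i [] = 0
wt i (a ∷ x) = if i ≡ᵇ a then suc (wt i x) else wt i x

-- α_i(x) = max over suffixes x̃ of x (including the empty one) of w_{i+1}(x̃) - w_i(x̃)
maxℤ : List ℤ → ℤ
maxℤ [] = + 0
maxℤ (a ∷ l) = a ⊔ maxℤ l

alpha : ℕ → List ℕ → ℤ
alpha i x = maxℤ (map (λ s → wt (suc i) s ⊖ wt i s) (tails x))

module Submission where

-- We record a partition μ by its column heights: height j μ is the length of
-- column j+1.  The operator u_{j+1} adds a box to column j+1, which succeeds
-- exactly when that column is shorter than column j (column 1 always accepts).
-- So running x on λ (last letter first) either gets blocked at some step, and
-- u_x λ = 0, or succeeds throughout (x is "applicable" to λ) and yields the
-- partition with heights height j λ + w_{j+1}(x).  The key criterion is that x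
-- is applicable to λ iff x "fits" on λ: for every j, α_{j+1}(x) plus the height
-- of column j+2 is at most the height of column j+1.  As column heights
-- determine a partition, equal weights and equal α give equal operators.
-- Conversely, on the partition whose column gaps are exactly α(x), x fits;
-- then u_y must produce the same partition, forcing w(y) = w(x) and
-- α(y) ≤ α(x), and the symmetric argument gives α(x) = α(y).

open import Defs
open import Data.Bool using (true; false; _∧_; if_then_else_)
open import Data.Bool.Properties using (T-≡; ¬-not)
open import Data.Empty using (⊥; ⊥-elim)
open import Data.Integer using (_⊖_) renaming (_⊔_ to _⊔ℤ_; +_ to ⁺_)
import Data.Integer.Properties as ℤ
open import Data.List using (List; []; _∷_; length; map; applyUpTo; replicate; _++_)
open import Data.List.Relation.Unary.All using (All; []; _∷_)
open import Data.Maybe using (Maybe; just; nothing)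
open import Data.Nat
open import Data.Nat.ListAction using (sum)
open import Data.Nat.Properties
open import Data.Product using (Σ; _×_; _,_; proj₁; proj₂)
open import Data.Unit using (⊤; tt)
open import Data.Vec using (Vec; toList)
open import Function.Bundles using (_⇔_; mk⇔; Equivalence)
open import Relation.Binary.Definitions using (tri<; tri≈; tri>)
open import Relation.Binary.PropositionalEquality
open import Relation.Nullary using (¬_; Dec; yes; no)

∧-true : ∀ {a b} → a ∧ b ≡ true → a ≡ true × b ≡ true
∧-true {true} b≡true = refl , b≡true

true-∧ : ∀ {a b} → a ≡ true → b ≡ true → a ∧ b ≡ true
true-∧ refl refl = refl

≡ᵇ-true : ∀ {m n} → m ≡ n → (m ≡ᵇ n) ≡ true
≡ᵇ-true {m} {n} m≡n = Equivalence.to T-≡ (≡⇒≡ᵇ m n m≡n)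

≡ᵇ-false : ∀ {m n} → m ≢ n → (m ≡ᵇ n) ≡ false
≡ᵇ-false {m} {n} m≢n = ¬-not (λ t → m≢n (≡ᵇ⇒≡ m n (Equivalence.from T-≡ t)))

≤ᵇ-true : ∀ {m n} → m ≤ n → (m ≤ᵇ n) ≡ true
≤ᵇ-true m≤n = Equivalence.to T-≡ (≤⇒≤ᵇ m≤n)

≤ᵇ-sound : ∀ {m n} → (m ≤ᵇ n) ≡ true → m ≤ n
≤ᵇ-sound {m} {n} t = ≤ᵇ⇒≤ m n (Equivalence.from T-≡ t)

BoundedBy : ℕ → List ℕ → Set
BoundedBy a [] = ⊤
BoundedBy a (b ∷ _) = b ≤ a

data Partition : List ℕ → Set where
  nil : Partition []
  cons : ∀ {a l} → 1 ≤ a → BoundedBy a l → Partition l → Partition (a ∷ l)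

BoundedBy-weaken : ∀ {a b} l → a ≤ b → BoundedBy a l → BoundedBy b l
BoundedBy-weaken [] _ _ = tt
BoundedBy-weaken (c ∷ l) a≤b c≤a = ≤-trans c≤a a≤b

positive-decreasing⇒Partition : ∀ l → allPositive l ≡ true → weaklyDecreasing l ≡ true → Partition l
positive-decreasing⇒Partition [] _ _ = nil
positive-decreasing⇒Partition (a ∷ []) pos _ = cons (≤ᵇ-sound (proj₁ (∧-true {1 ≤ᵇ a} pos))) tt nil
positive-decreasing⇒Partition (a ∷ b ∷ l) pos dec =
  cons (≤ᵇ-sound (proj₁ pos′)) (≤ᵇ-sound (proj₁ dec′))
       (positive-decreasing⇒Partition (b ∷ l) (proj₂ pos′) (proj₂ dec′))
  where
  pos′ = ∧-true {1 ≤ᵇ a} pos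
  dec′ = ∧-true {b ≤ᵇ a} dec

Partition⇒positive : ∀ {l} → Partition l → allPositive l ≡ true
Partition⇒positive nil = refl
Partition⇒positive (cons a>0 _ q) = true-∧ (≤ᵇ-true a>0) (Partition⇒positive q)

Partition⇒decreasing : ∀ {l} → Partition l → weaklyDecreasing l ≡ true
Partition⇒decreasing nil = refl
Partition⇒decreasing (cons {l = []} _ _ _) = refl
Partition⇒decreasing (cons {l = b ∷ l} _ b≤a q) = true-∧ (≤ᵇ-true b≤a) (Partition⇒decreasing q)

isPartition⇒Partition : ∀ {l} → IsPartition l → Partition l
isPartition⇒Partition {l} p = positive-decreasing⇒Partition l (proj₁ (∧-true p)) (proj₂ (∧-true p))

Partition⇒isPartition : ∀ {l} → Partition l → IsPartition l
Partition⇒isPartition q = true-∧ (Partition⇒positive q) (Partition⇒decreasing q)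

rowLen-bounded : ∀ {a l} → BoundedBy a l → Partition l → ∀ i → rowLen i l ≤ a
rowLen-bounded _ nil i = z≤n
rowLen-bounded b≤a (cons _ _ _) zero = b≤a
rowLen-bounded b≤a (cons {l = l} _ c≤b q) (suc i) = rowLen-bounded (BoundedBy-weaken l b≤a c≤b) q i

rowLen-antitone : ∀ {μ} → Partition μ → ∀ {p i} → p ≤ i → rowLen i μ ≤ rowLen p μ
rowLen-antitone nil _ = z≤n
rowLen-antitone (cons _ _ _) {i = zero} z≤n = ≤-refl
rowLen-antitone (cons _ b≤a q) {i = suc i} z≤n = rowLen-bounded b≤a q i
rowLen-antitone (cons _ _ q) (s≤s p≤i) = rowLen-antitone q p≤i

-- height j μ: the length of column j+1 of μ, i.e. the number of leading rows
-- of μ that are longer than j.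
height : ℕ → List ℕ → ℕ
height j [] = 0
height j (a ∷ l) with j <? a
... | yes _ = suc (height j l)
... | no _ = 0

height-long : ∀ {j a} l → j < a → height j (a ∷ l) ≡ suc (height j l)
height-long {j} {a} l j<a with j <? a
... | yes _ = refl
... | no j≮a = ⊥-elim (j≮a j<a)

height-short : ∀ {j a} l → ¬ j < a → height j (a ∷ l) ≡ 0
height-short {j} {a} l j≮a with j <? a
... | yes j<a = ⊥-elim (j≮a j<a)
... | no _ = refl

above-height⇒long : ∀ j μ r → r < height j μ → j < rowLen r μ
above-height⇒long j (a ∷ l) r r<h with j <? a
above-height⇒long j (a ∷ l) zero _ | yes j<a = j<a
above-height⇒long j (a ∷ l) (suc r) (s≤s r<h) | yes _ = above-height⇒long j l r r<h

rowLen-at-height : ∀ j μ → rowLen (height j μ) μ ≤ j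
rowLen-at-height j [] = z≤n
rowLen-at-height j (a ∷ l) with j <? a
... | yes _ = rowLen-at-height j l
... | no j≮a = ≮⇒≥ j≮a

long-prefix⇒above-height : ∀ j μ p → j < rowLen p μ → (∀ r → r < p → j < rowLen r μ) → p < height j μ
long-prefix⇒above-height j (a ∷ l) zero j<a _ rewrite height-long l j<a = s≤s z≤n
long-prefix⇒above-height j (a ∷ l) (suc p) j<row long rewrite height-long l (long 0 (s≤s z≤n)) =
  s≤s (long-prefix⇒above-height j l p j<row (λ r r<p → long (suc r) (s≤s r<p)))

height-vanishes : ∀ {a} j l → BoundedBy a l → a ≤ j → height j l ≡ 0
height-vanishes j [] _ _ = refl
height-vanishes j (b ∷ l) b≤a a≤j = height-short l (λ j<b → <⇒≱ j<b (≤-trans b≤a a≤j))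

height≤length : ∀ j μ → height j μ ≤ length μ
height≤length j [] = z≤n
height≤length j (a ∷ l) with j <? a
... | yes _ = s≤s (height≤length j l)
... | no _ = z≤n

height-antitone : ∀ j μ → height (suc j) μ ≤ height j μ
height-antitone j [] = z≤n
height-antitone j (a ∷ l) with suc j <? a
... | no _ = z≤n
... | yes j+1<a rewrite height-long {j} l (<-trans (n<1+n j) j+1<a) = s≤s (height-antitone j l)

height-injective : ∀ {μ ν} → Partition μ → Partition ν → (∀ j → height j μ ≡ height j ν) → μ ≡ ν
height-injective nil nil _ = refl
height-injective nil (cons {l = m} b>0 _ _) h = ⊥-elim (1+n≢0 (sym (trans (h 0) (height-long m b>0))))
height-injective (cons {l = l} a>0 _ _) nil h = ⊥-elim (1+n≢0 (trans (sym (height-long l a>0)) (h 0)))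
height-injective (cons {a} {l} _ ha ql) (cons {b} {m} _ hb qm) h with <-cmp a b
... | tri< a<b _ _ = ⊥-elim (1+n≢0 (sym (trans (sym (height-short l (<-irrefl refl))) (trans (h a) (height-long m a<b)))))
... | tri> _ _ b<a = ⊥-elim (1+n≢0 (trans (sym (height-long l b<a)) (trans (h b) (height-short m (<-irrefl refl)))))
... | tri≈ _ refl _ = cong (a ∷_) (height-injective ql qm tails)
  where
  tails : ∀ j → height j l ≡ height j m
  tails j with j <? a
  ... | yes j<a = suc-injective (trans (sym (height-long l j<a)) (trans (h j) (height-long m j<a)))
  ... | no j≮a = trans (height-vanishes j l ha (≮⇒≥ j≮a)) (sym (height-vanishes j m hb (≮⇒≥ j≮a)))

-- u_{j+1} puts its box at the end of the first row of length ≤ j, row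
-- height j μ; the box lies in column j+1 exactly when that row has length j.
addBox : ℕ → List ℕ → List ℕ
addBox j μ = incAt (height j μ) μ

CanAdd : ℕ → List ℕ → Set
CanAdd j μ = rowLen (height j μ) μ ≡ j

addBox-bounded : ∀ {a j} l → j < a → BoundedBy a l → CanAdd j l → BoundedBy a (addBox j l)
addBox-bounded [] j<a _ _ = ≤-trans (s≤s z≤n) j<a
addBox-bounded {j = j} (b ∷ l) j<a b≤a row≡j with j <? b
... | yes _ = b≤a
... | no _ rewrite row≡j = j<a

addBox-partition : ∀ j {μ} → Partition μ → CanAdd j μ → Partition (addBox j μ)
addBox-partition j nil refl = cons (s≤s z≤n) tt nil
addBox-partition j (cons {a} {l} a>0 b≤a q) row≡j with j <? a
... | yes j<a = cons a>0 (addBox-bounded l j<a b≤a row≡j) (addBox-partition j q row≡j)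
... | no _ = cons (s≤s z≤n) (BoundedBy-weaken l (n≤1+n a) b≤a) q

addBox-height-same : ∀ j {μ} → Partition μ → CanAdd j μ → height j (addBox j μ) ≡ suc (height j μ)
addBox-height-same j nil refl = refl
addBox-height-same j (cons {a} {l} _ b≤a q) row≡j with j <? a
... | yes j<a rewrite height-long (addBox j l) j<a = cong suc (addBox-height-same j q row≡j)
... | no _ rewrite row≡j = trans (height-long l (n<1+n j)) (cong suc (height-vanishes j l b≤a ≤-refl))

addBox-height-other : ∀ j k {μ} → Partition μ → CanAdd j μ → k ≢ j → height k (addBox j μ) ≡ height k μ
addBox-height-other j zero nil refl k≢j = ⊥-elim (k≢j refl)
addBox-height-other j (suc k) nil refl k≢j = refl
addBox-height-other j k (cons {a} {l} _ _ q) row≡j k≢j with j <? a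
... | yes j<a with k <? a
...   | yes _ = cong suc (addBox-height-other j k q row≡j k≢j)
...   | no _ = refl
addBox-height-other j k (cons {a} {l} _ _ q) row≡j k≢j | no _ with <-cmp k a
... | tri< k<a _ _ = trans (height-long l (≤-trans k<a (n≤1+n a))) (sym (height-long l k<a))
... | tri≈ _ k≡a _ = ⊥-elim (k≢j (trans k≡a row≡j))
... | tri> _ _ a<k = trans (height-short l (λ k<a+1 → <⇒≱ a<k (≤-pred k<a+1)))
                           (sym (height-short l (λ k<a → <⇒≱ k<a (<⇒≤ a<k))))

-- The row-by-row candidates scanned by schurOp (suc j) μ.
candidate : ℕ → List ℕ → ℕ → Maybe (List ℕ)
candidate j μ r = if (rowLen r μ ≡ᵇ j) ∧ isPartition (incAt r μ) then just (incAt r μ) else nothing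

candidate-wrong-row : ∀ j μ r → rowLen r μ ≢ j → candidate j μ r ≡ nothing
candidate-wrong-row j μ r row≢j rewrite ≡ᵇ-false row≢j = refl

candidate-right-row : ∀ j μ r → rowLen r μ ≡ j → IsPartition (incAt r μ) → candidate j μ r ≡ just (incAt r μ)
candidate-right-row j μ r row≡j p rewrite ≡ᵇ-true row≡j | p = refl

firstJust-hit : ∀ (f : ℕ → Maybe (List ℕ)) n g k {ν} → k < n → (∀ i → i < k → f (g i) ≡ nothing) →
                f (g k) ≡ just ν → firstJust (map f (applyUpTo g n)) ≡ just ν
firstJust-hit f (suc n) g zero _ _ hit rewrite hit = refl
firstJust-hit f (suc n) g (suc k) (s≤s k<n) misses hit rewrite misses 0 (s≤s z≤n) =
  firstJust-hit f n (λ i → g (suc i)) k k<n (λ i i<k → misses (suc i) (s≤s i<k)) hit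

firstJust-miss : ∀ (f : ℕ → Maybe (List ℕ)) n g → (∀ i → i < n → f (g i) ≡ nothing) →
                 firstJust (map f (applyUpTo g n)) ≡ nothing
firstJust-miss f zero g _ = refl
firstJust-miss f (suc n) g misses rewrite misses 0 (s≤s z≤n) =
  firstJust-miss f n (λ i → g (suc i)) (λ i i<n → misses (suc i) (s≤s i<n))

schurOp-add : ∀ j {μ} → Partition μ → CanAdd j μ → schurOp (suc j) μ ≡ just (addBox j μ)
schurOp-add j {μ} q row≡j =
  firstJust-hit (candidate j μ) (suc (length μ)) (λ i → i) (height j μ) (s≤s (height≤length j μ))
    (λ i i<h → candidate-wrong-row j μ i (λ e → <⇒≢ (above-height⇒long j μ i i<h) (sym e)))
    (candidate-right-row j μ (height j μ) row≡j (Partition⇒isPartition (addBox-partition j q row≡j)))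

schurOp-blocked : ∀ j {μ} → Partition μ → ¬ CanAdd j μ → schurOp (suc j) μ ≡ nothing
schurOp-blocked j {μ} q ¬can = firstJust-miss (candidate j μ) (suc (length μ)) (λ i → i) miss
  where
  short : rowLen (height j μ) μ < j
  short = ≤∧≢⇒< (rowLen-at-height j μ) ¬can
  miss : ∀ i → i < suc (length μ) → candidate j μ i ≡ nothing
  miss i _ with i <? height j μ
  ... | yes i<h = candidate-wrong-row j μ i (λ e → <⇒≢ (above-height⇒long j μ i i<h) (sym e))
  ... | no i≮h = candidate-wrong-row j μ i (λ e → <⇒≢ (≤-<-trans (rowLen-antitone q (≮⇒≥ i≮h)) short) e)

-- Addability read off a profile h of column heights (h k = column k+1):
-- column 1 always accepts a box, column j+2 only when shorter than column j+1.
Addable : ℕ → (ℕ → ℕ) → Set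
Addable zero h = ⊤
Addable (suc j) h = h (suc j) < h j

addable? : ∀ j h → Dec (Addable j h)
addable? zero h = yes tt
addable? (suc j) h = h (suc j) <? h j

addable⇒canAdd : ∀ j {μ} h → (∀ k → height k μ ≡ h k) → Addable j h → CanAdd j μ
addable⇒canAdd zero {μ} h _ _ = n≤0⇒n≡0 (rowLen-at-height 0 μ)
addable⇒canAdd (suc j) {μ} h heights shorter rewrite sym (heights j) | sym (heights (suc j)) =
  ≤-antisym (rowLen-at-height (suc j) μ) (above-height⇒long j μ (height (suc j) μ) shorter)

canAdd⇒addable : ∀ j {μ} h → (∀ k → height k μ ≡ h k) → CanAdd j μ → Addable j h
canAdd⇒addable zero h _ _ = tt
canAdd⇒addable (suc j) {μ} h heights row≡j rewrite sym (heights j) | sym (heights (suc j)) =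
  long-prefix⇒above-height j μ (height (suc j) μ) (subst (j <_) (sym row≡j) (n<1+n j))
    (λ r r<h → <-trans (n<1+n j) (above-height⇒long (suc j) μ r r<h))

wt-same : ∀ j x → wt j (j ∷ x) ≡ suc (wt j x)
wt-same j x rewrite ≡ᵇ-true {j} refl = refl

wt-other : ∀ k j x → k ≢ j → wt k (j ∷ x) ≡ wt k x
wt-other k j x k≢j rewrite ≡ᵇ-false k≢j = refl

wt-cons : ∀ k a x → wt k x ≤ wt k (a ∷ x)
wt-cons k a x with k ≟ a
... | yes refl rewrite wt-same k x = n≤1+n _
... | no k≢a rewrite wt-other k a x k≢a = ≤-refl

heightsAfter : List ℕ → List ℕ → ℕ → ℕ
heightsAfter x λ' k = height k λ' + wt (suc k) x

Applicable : List ℕ → List ℕ → Set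
Applicable [] λ' = ⊤
Applicable (zero ∷ x) λ' = ⊥
Applicable (suc j ∷ x) λ' = Applicable x λ' × Addable j (heightsAfter x λ')

applicable? : ∀ x λ' → Dec (Applicable x λ')
applicable? [] λ' = yes tt
applicable? (zero ∷ x) λ' = no (λ ())
applicable? (suc j ∷ x) λ' with applicable? x λ' | addable? j (heightsAfter x λ')
... | yes ok | yes add = yes (ok , add)
... | no ¬ok | _ = no (λ p → ¬ok (proj₁ p))
... | _ | no ¬add = no (λ p → ¬add (proj₂ p))

Grown : List ℕ → List ℕ → List ℕ → Set
Grown x λ' μ = Partition μ × (∀ j → height j μ ≡ heightsAfter x λ' j)

schurWord-applicable : ∀ x {λ'} → Partition λ' → Applicable x λ' →
                       Σ (List ℕ) (λ μ → schurWord x λ' ≡ just μ × Grown x λ' μ)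
schurWord-applicable [] {λ'} q _ = λ' , refl , q , (λ j → sym (+-identityʳ _))
schurWord-applicable (suc j ∷ x) {λ'} q (ok , add) with schurWord-applicable x q ok
... | μ , run , pμ , hμ = addBox j μ , run′ , addBox-partition j pμ can , heights
  where
  can : CanAdd j μ
  can = addable⇒canAdd j {μ} (heightsAfter x λ') hμ add
  run′ : schurWord (suc j ∷ x) λ' ≡ just (addBox j μ)
  run′ rewrite run = schurOp-add j pμ can
  heights : ∀ k → height k (addBox j μ) ≡ heightsAfter (suc j ∷ x) λ' k
  heights k with k ≟ j
  ... | yes refl rewrite addBox-height-same k pμ can | hμ k | wt-same (suc k) x = sym (+-suc _ _)
  ... | no k≢j rewrite addBox-height-other j k pμ can k≢j | hμ k
                     | wt-other (suc k) (suc j) x (λ e → k≢j (suc-injective e)) = refl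

schurWord-blocked : ∀ x {λ'} → Partition λ' → ¬ Applicable x λ' → schurWord x λ' ≡ nothing
schurWord-blocked [] q ¬ok = ⊥-elim (¬ok tt)
schurWord-blocked (a ∷ x) {λ'} q ¬ok with applicable? x λ'
... | no ¬okx rewrite schurWord-blocked x q ¬okx = refl
... | yes okx with schurWord-applicable x q okx
... | μ , run , pμ , hμ rewrite run = lastLetter a ¬ok
  where
  lastLetter : ∀ a → ¬ Applicable (a ∷ x) λ' → schurOp a μ ≡ nothing
  lastLetter zero _ = refl
  lastLetter (suc j) ¬ok′ =
    schurOp-blocked j pμ (λ can → ¬ok′ (okx , canAdd⇒addable j {μ} (heightsAfter x λ') hμ can))

schurWord-grows : ∀ x {λ' μ} → Partition λ' → schurWord x λ' ≡ just μ → Applicable x λ' × Grown x λ' μ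
schurWord-grows x {λ'} q run with applicable? x λ'
... | no ¬ok with trans (sym run) (schurWord-blocked x q ¬ok)
...   | ()
schurWord-grows x {λ'} q run | yes ok with schurWord-applicable x q ok
... | μ , run′ , grown with trans (sym run) run′
...   | refl = ok , grown

suffixGap : ℕ → List ℕ → ℕ
suffixGap i s = wt (suc i) s ∸ wt i s

-- α_i as a natural number: the maximum of suffixGap i over the suffixes.
-- Truncating at 0 loses nothing, since the empty suffix contributes 0.
excess : ℕ → List ℕ → ℕ
excess i [] = 0
excess i (a ∷ x) = suffixGap i (a ∷ x) ⊔ excess i x

⊖-⊔-+ : ∀ p q m → (p ⊖ q) ⊔ℤ ⁺ m ≡ ⁺ ((p ∸ q) ⊔ m)
⊖-⊔-+ zero zero m = refl
⊖-⊔-+ zero (suc q) m = refl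
⊖-⊔-+ (suc p) zero m = refl
⊖-⊔-+ (suc p) (suc q) m rewrite ℤ.[1+m]⊖[1+n]≡m⊖n p q = ⊖-⊔-+ p q m

alpha≡excess : ∀ i x → alpha i x ≡ ⁺ excess i x
alpha≡excess i [] = refl
alpha≡excess i (a ∷ x) rewrite alpha≡excess i x = ⊖-⊔-+ (wt (suc i) (a ∷ x)) (wt i (a ∷ x)) (excess i x)

suffixGap≤excess : ∀ i x → suffixGap i x ≤ excess i x
suffixGap≤excess i [] = z≤n
suffixGap≤excess i (a ∷ x) = m≤m⊔n _ _

-- Letters larger than the sum of a word do not occur in it, so far-right
-- excesses vanish.
wt-vanishes : ∀ k z → sum z < k → wt k z ≡ 0
wt-vanishes k [] _ = refl
wt-vanishes k (a ∷ z) sum<k =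
  trans (wt-other k a z (λ k≡a → <⇒≢ (≤-<-trans (m≤m+n a (sum z)) sum<k) (sym k≡a)))
        (wt-vanishes k z (≤-<-trans (m≤n+m (sum z) a) sum<k))

excess-vanishes : ∀ i z → sum z ≤ i → excess i z ≡ 0
excess-vanishes i [] _ = refl
excess-vanishes i (a ∷ z) sum≤i rewrite wt-vanishes (suc i) (a ∷ z) (s≤s sum≤i)
  | excess-vanishes i z (≤-trans (m≤n+m (sum z) a) sum≤i) | 0∸n≡0 (wt i (a ∷ z)) = refl

Fits : List ℕ → List ℕ → Set
Fits x λ' = ∀ j → excess (suc j) x + height (suc j) λ' ≤ height j λ'

-- Arithmetic core of the criterion for a letter j+2: p and q count the
-- letters j+2 and j+1 in the rest of the word, r ≤ t are the heights of
-- columns j+2 and j+1.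
strict⇒gap-fits : ∀ p q r t → r + p < t + q → r ≤ t → (suc p ∸ q) + r ≤ t
strict⇒gap-fits p q r t strict r≤t with suc p ≤? q
... | yes p<q rewrite m≤n⇒m∸n≡0 p<q = r≤t
... | no p≮q = +-cancelʳ-≤ q _ t (subst (_≤ t + q) regroup strict)
  where
  open ≡-Reasoning
  regroup : suc (r + p) ≡ (suc p ∸ q) + r + q
  regroup = begin
    suc (r + p)           ≡⟨ cong suc (+-comm r p) ⟩
    suc p + r             ≡⟨ cong (_+ r) (sym (m∸n+n≡m (≰⇒≥ p≮q))) ⟩
    (suc p ∸ q) + q + r   ≡⟨ +-assoc (suc p ∸ q) q r ⟩
    (suc p ∸ q) + (q + r) ≡⟨ cong ((suc p ∸ q) +_) (+-comm q r) ⟩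
    (suc p ∸ q) + (r + q) ≡⟨ sym (+-assoc (suc p ∸ q) r q) ⟩
    (suc p ∸ q) + r + q   ∎

gap-fits⇒strict : ∀ p q r t → (suc p ∸ q) + r ≤ t → r + p < t + q
gap-fits⇒strict p q r t fits = begin-strict
    r + p                 <⟨ +-monoʳ-< r (n<1+n p) ⟩
    r + suc p             ≤⟨ +-monoʳ-≤ r (m≤n+m∸n (suc p) q) ⟩
    r + (q + (suc p ∸ q)) ≡⟨ cong (r +_) (+-comm q _) ⟩
    r + ((suc p ∸ q) + q) ≡⟨ sym (+-assoc r _ q) ⟩
    r + (suc p ∸ q) + q   ≡⟨ cong (_+ q) (+-comm r _) ⟩
    (suc p ∸ q) + r + q   ≤⟨ +-monoˡ-≤ q fits ⟩
    t + q                 ∎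
  where open ≤-Reasoning

fits-tail : ∀ a x {λ'} → Fits (a ∷ x) λ' → Fits x λ'
fits-tail a x {λ'} fits j =
  ≤-trans (+-monoˡ-≤ (height (suc j) λ') (m≤n⊔m (suffixGap (suc j) (a ∷ x)) (excess (suc j) x))) (fits j)

fits-cons : ∀ j x {λ'} → Fits x λ' → Addable j (heightsAfter x λ') → Fits (suc j ∷ x) λ'
fits-cons j x {λ'} fits add k =
  subst (_≤ height k λ') (sym (+-distribʳ-⊔ (height (suc k) λ') _ (excess (suc k) x)))
        (⊔-lub newSuffix (fits k))
  where
  newSuffix : suffixGap (suc k) (suc j ∷ x) + height (suc k) λ' ≤ height k λ'
  newSuffix with j ≟ suc k
  ... | yes refl rewrite wt-same (suc (suc k)) x | wt-other (suc k) (suc (suc k)) x (λ e → 1+n≢n (sym e)) =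
    strict⇒gap-fits (wt (suc (suc k)) x) (wt (suc k) x) (height (suc k) λ') (height k λ') add (height-antitone k λ')
  ... | no j≢k+1 rewrite wt-other (suc (suc k)) (suc j) x (λ e → j≢k+1 (suc-injective (sym e))) =
    ≤-trans (+-monoˡ-≤ (height (suc k) λ')
              (≤-trans (∸-monoʳ-≤ (wt (suc (suc k)) x) (wt-cons (suc k) (suc j) x)) (suffixGap≤excess (suc k) x)))
            (fits k)

fits-cons⁻¹ : ∀ j x {λ'} → Fits (suc j ∷ x) λ' → Addable j (heightsAfter x λ')
fits-cons⁻¹ zero x _ = tt
fits-cons⁻¹ (suc k) x {λ'} fits = gap-fits⇒strict (wt (suc (suc k)) x) (wt (suc k) x) (height (suc k) λ') (height k λ') newSuffix
  where
  newSuffix : (suc (wt (suc (suc k)) x) ∸ wt (suc k) x) + height (suc k) λ' ≤ height k λ'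
  newSuffix rewrite sym (wt-same (suc (suc k)) x) | sym (wt-other (suc k) (suc (suc k)) x (λ e → 1+n≢n (sym e))) =
    ≤-trans (+-monoˡ-≤ (height (suc k) λ') (m≤m⊔n _ (excess (suc k) x))) (fits k)

applicable⇒fits : ∀ x {λ'} → Applicable x λ' → Fits x λ'
applicable⇒fits [] {λ'} _ j = height-antitone j λ'
applicable⇒fits (suc j ∷ x) {λ'} (ok , add) = fits-cons j x {λ'} (applicable⇒fits x ok) add

fits⇒applicable : ∀ x {λ'} → All (1 ≤_) x → Fits x λ' → Applicable x λ'
fits⇒applicable [] _ _ = tt
fits⇒applicable (suc j ∷ x) {λ'} (_ ∷ pos) fits =
  fits⇒applicable x pos (fits-tail (suc j) x {λ'} fits) , fits-cons⁻¹ j x {λ'} fits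

-- stack N d: the partition with d c rows of length c for c = N, …, 1.  For
-- j < N its column j+1 exceeds column j+2 by exactly d (j+1).
stack : ℕ → (ℕ → ℕ) → List ℕ
stack zero d = []
stack (suc c) d = replicate (d (suc c)) (suc c) ++ stack c d

height-replicate-long : ∀ j v n l → j < v → height j (replicate n v ++ l) ≡ n + height j l
height-replicate-long j v zero l _ = refl
height-replicate-long j v (suc n) l j<v =
  trans (height-long (replicate n v ++ l) j<v) (cong suc (height-replicate-long j v n l j<v))

height-replicate-short : ∀ j v n l → v ≤ j → height j l ≡ 0 → height j (replicate n v ++ l) ≡ 0
height-replicate-short j v zero l _ h≡0 = h≡0
height-replicate-short j v (suc n) l v≤j _ = height-short (replicate n v ++ l) (λ j<v → <⇒≱ j<v v≤j)

height-stack-beyond : ∀ j c d → c ≤ j → height j (stack c d) ≡ 0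
height-stack-beyond j zero d _ = refl
height-stack-beyond j (suc c) d c<j =
  height-replicate-short j (suc c) (d (suc c)) (stack c d) c<j (height-stack-beyond j c d (<⇒≤ c<j))

height-stack-step : ∀ j c d → j < c → height j (stack c d) ≡ d (suc j) + height (suc j) (stack c d)
height-stack-step j (suc c) d (s≤s j≤c) with j ≟ c
... | yes refl
  rewrite height-replicate-long j (suc j) (d (suc j)) (stack j d) (n<1+n j)
        | height-stack-beyond j j d ≤-refl
        | height-replicate-short (suc j) (suc j) (d (suc j)) (stack j d) ≤-refl (height-stack-beyond (suc j) j d (n≤1+n j))
  = refl
... | no j≢c
  rewrite height-replicate-long j (suc c) (d (suc c)) (stack c d) (s≤s j≤c)
        | height-replicate-long (suc j) (suc c) (d (suc c)) (stack c d) (s≤s (≤∧≢⇒< j≤c j≢c))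
        | height-stack-step j c d (≤∧≢⇒< j≤c j≢c)
  = swap-front (d (suc c)) (d (suc j)) (height (suc j) (stack c d))
  where
  swap-front : ∀ a b h → a + (b + h) ≡ b + (a + h)
  swap-front a b h = trans (sym (+-assoc a b h)) (trans (cong (_+ h) (+-comm a b)) (+-assoc b a h))

replicate-bounded : ∀ v n l → BoundedBy v l → BoundedBy v (replicate n v ++ l)
replicate-bounded v zero l b = b
replicate-bounded v (suc n) l _ = ≤-refl

replicate-partition : ∀ v n l → 1 ≤ v → BoundedBy v l → Partition l → Partition (replicate n v ++ l)
replicate-partition v zero l _ _ q = q
replicate-partition v (suc n) l v>0 b q = cons v>0 (replicate-bounded v n l b) (replicate-partition v n l v>0 b q)

stack-bounded : ∀ c d → BoundedBy c (stack c d)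
stack-bounded zero d = tt
stack-bounded (suc c) d =
  replicate-bounded (suc c) (d (suc c)) (stack c d) (BoundedBy-weaken (stack c d) (n≤1+n c) (stack-bounded c d))

stack-partition : ∀ c d → Partition (stack c d)
stack-partition zero d = nil
stack-partition (suc c) d =
  replicate-partition (suc c) (d (suc c)) (stack c d) (s≤s z≤n)
    (BoundedBy-weaken (stack c d) (n≤1+n c) (stack-bounded c d)) (stack-partition c d)

-- The gap partition of x (with N at least the sum of x): consecutive column
-- gaps are exactly the excesses of x, so x fits on it, and tightly so: any
-- word fitting on it has excesses at most those of x.
gapPartition : ℕ → List ℕ → List ℕ
gapPartition N x = stack N (λ c → excess c x)

gapPartition-fits : ∀ N x → sum x ≤ N → Fits x (gapPartition N x)
gapPartition-fits N x sum≤N j with suc j ≤? N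
... | yes j<N rewrite height-stack-step j N (λ c → excess c x) j<N = ≤-refl
... | no j≮N rewrite height-stack-beyond j N (λ c → excess c x) (≮⇒≥ j≮N)
                   | height-stack-beyond (suc j) N (λ c → excess c x) (≤-trans (≮⇒≥ j≮N) (n≤1+n j))
                   | excess-vanishes (suc j) x (≤-trans sum≤N (≤-trans (≮⇒≥ j≮N) (n≤1+n j))) = ≤-refl

fits-gapPartition⇒excess≤ : ∀ N x y → sum y ≤ N → Fits y (gapPartition N x) → ∀ j → excess (suc j) y ≤ excess (suc j) x
fits-gapPartition⇒excess≤ N x y sum≤N fits j with suc j ≤? N
... | yes j<N = +-cancelʳ-≤ (height (suc j) Λ) _ _
                  (subst (excess (suc j) y + height (suc j) Λ ≤_) (height-stack-step j N (λ c → excess c x) j<N) (fits j))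
  where Λ = gapPartition N x
... | no j≮N rewrite excess-vanishes (suc j) y (≤-trans sum≤N (≤-trans (≮⇒≥ j≮N) (n≤1+n j))) = z≤n

-- Sufficiency.  Applicability depends only on the excesses, and applicable
-- words with equal weights grow λ into the same partition.
applicable-transfer : ∀ x y {λ'} → All (1 ≤_) y → (∀ j → excess (suc j) x ≡ excess (suc j) y) →
                      Applicable x λ' → Applicable y λ'
applicable-transfer x y {λ'} pos same okx = fits⇒applicable y pos fitsy
  where
  fitsy : Fits y λ'
  fitsy j rewrite sym (same j) = applicable⇒fits x okx j

same-growth : ∀ x y {λ'} → Partition λ' → Applicable x λ' → Applicable y λ' →
              (∀ j → wt (suc j) x ≡ wt (suc j) y) → schurWord x λ' ≡ schurWord y λ'
same-growth x y {λ'} q okx oky same with schurWord-applicable x q okx | schurWord-applicable y q oky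
... | μ , runx , pμ , hμ | ν , runy , pν , hν rewrite runx | runy =
  cong just (height-injective pμ pν (λ j → trans (hμ j) (trans (cong (height j λ' +_) (same j)) (sym (hν j)))))

sufficiency : ∀ x y → All (1 ≤_) x → All (1 ≤_) y → (∀ j → wt (suc j) x ≡ wt (suc j) y) →
              (∀ j → excess (suc j) x ≡ excess (suc j) y) → EquivModI x y
sufficiency x y px py weights same λ' p with applicable? x λ'
... | yes okx = same-growth x y q okx (applicable-transfer x y py same okx) weights
  where q = isPartition⇒Partition p
... | no ¬okx = trans (schurWord-blocked x q ¬okx) (sym (schurWord-blocked y q ¬oky))
  where
  q = isPartition⇒Partition p
  ¬oky : ¬ Applicable y λ'
  ¬oky oky = ¬okx (applicable-transfer y x px (λ j → sym (same j)) oky)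

-- Necessity, one direction: u_x does not vanish on the gap partition Λ of x,
-- so u_y maps Λ to the same partition; comparing column heights gives
-- w(x) = w(y), and y then fits on Λ, giving α(y) ≤ α(x).
necessity : ∀ N x y → All (1 ≤_) x → EquivModI x y → sum x ≤ N → sum y ≤ N →
            (∀ j → wt (suc j) x ≡ wt (suc j) y) × (∀ j → excess (suc j) y ≤ excess (suc j) x)
necessity N x y px equiv sumx sumy =
  let _ , runx , _ , heightsx = schurWord-applicable x qΛ (fits⇒applicable x px (gapPartition-fits N x sumx))
      oky , _ , heightsy = schurWord-grows y qΛ (trans (sym (equiv Λ (Partition⇒isPartition qΛ))) runx)
  in (λ j → +-cancelˡ-≡ (height j Λ) _ _ (trans (sym (heightsx j)) (heightsy j)))
   , fits-gapPartition⇒excess≤ N x y sumy (applicable⇒fits y oky)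
  where
  Λ : List ℕ
  Λ = gapPartition N x
  qΛ : Partition Λ
  qΛ = stack-partition N (λ c → excess c x)

-- The theorem: split the index i ≥ 1 as i = j + 1 and pass between α and
-- its natural-number form; for necessity take N = sum x + sum y and use
-- both directions of the equivalence.
mainTheorem4 : (l : ℕ) (x y : Vec ℕ l) →
    All (1 ≤_) (toList x) → All (1 ≤_) (toList y) →
    (EquivModI (toList x) (toList y) ⇔
      (((i : ℕ) → 1 ≤ i → wt i (toList x) ≡ wt i (toList y)) ×
       ((i : ℕ) → 1 ≤ i → alpha i (toList x) ≡ alpha i (toList y))))
mainTheorem4 l x y px py = mk⇔ necessary sufficient
  where
  X = toList x
  Y = toList y
  N = sum X + sum Y
  sumX≤N : sum X ≤ N
  sumX≤N = m≤m+n (sum X) (sum Y)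
  sumY≤N : sum Y ≤ N
  sumY≤N = m≤n+m (sum Y) (sum X)
  necessary : EquivModI X Y → ((i : ℕ) → 1 ≤ i → wt i X ≡ wt i Y) × ((i : ℕ) → 1 ≤ i → alpha i X ≡ alpha i Y)
  necessary equiv = weights , alphas
    where
    x→y = necessity N X Y px equiv sumX≤N sumY≤N
    y→x = necessity N Y X py (λ λ' p → sym (equiv λ' p)) sumY≤N sumX≤N
    weights : (i : ℕ) → 1 ≤ i → wt i X ≡ wt i Y
    weights (suc j) _ = proj₁ x→y j
    alphas : (i : ℕ) → 1 ≤ i → alpha i X ≡ alpha i Y
    alphas (suc j) _ = begin
      alpha (suc j) X    ≡⟨ alpha≡excess (suc j) X ⟩
      ⁺ excess (suc j) X ≡⟨ cong ⁺_ (≤-antisym (proj₂ y→x j) (proj₂ x→y j)) ⟩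
      ⁺ excess (suc j) Y ≡⟨ sym (alpha≡excess (suc j) Y) ⟩
      alpha (suc j) Y    ∎
      where open ≡-Reasoning
  sufficient : ((i : ℕ) → 1 ≤ i → wt i X ≡ wt i Y) × ((i : ℕ) → 1 ≤ i → alpha i X ≡ alpha i Y) → EquivModI X Y
  sufficient (weights , alphas) = sufficiency X Y px py (λ j → weights (suc j) (s≤s z≤n)) excesses
    where
    excesses : ∀ j → excess (suc j) X ≡ excess (suc j) Y
    excesses j = ℤ.+-injective (trans (sym (alpha≡excess (suc j) X))
                                      (trans (alphas (suc j) (s≤s z≤n)) (alpha≡excess (suc j) Y)))
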